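{- Let $G$ be a graph on $n$ vertices and $x\ge0$. Let $\{V_1,V_2\}$ and $\{V_1',V_2'\}$ be partitions of $V(G)$ into nonempty parts with $|V_1|\le|V_2|$ and $|V_1'|\le|V_2'|$, such that $G[V_1]$ and $G[V_1']$ contain no missing edges and $G[V_2]$ and $G[V_2']$ each contain exactly $x$ missing edges. If $|V_2|\le|V_2'|$, then $d(\{V_1,V_2\})\le d(\{V_1',V_2'\})$.
   Context: A missing edge inside a vertex set $S$ is a pair of distinct non-adjacent vertices of $S$. For $S\subseteq V$, $d(S)=|E(S)|/|S|$ with $E(S)$ the set of edges with both endpoints in $S$; for a partition $\mathcal{P}$, $d(\mathcal{P})=\sum_{P\in\mathcal{P}}d(P)$. -}

module Defs where

open import Data.Nat using (ℕ; zero; suc; _<ᵇ_)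
open import Data.Bool using (Bool; true; false; _∧_; not; if_then_else_)
open import Data.Fin using (Fin; toℕ)
open import Data.Fin.Subset using (Subset; ∣_∣; ∁)
open import Data.List using (List; []; _∷_; concatMap; allFin)
open import Data.Vec using (lookup)
open import Data.Product using (_×_; _,_)
open import Data.Integer using (+_)
open import Data.Rational using (ℚ; _/_; _+_)
open import Relation.Binary.PropositionalEquality using (_≡_)

record Graph (n : ℕ) : Set where
  field
    adj     : Fin n → Fin n → Bool
    adj-sym : ∀ i j → adj i j ≡ adj j i
    adj-irr : ∀ i → adj i i ≡ false
open Graph public

inS : ∀ {n} → Subset n → Fin n → Bool
inS S i = lookup S i

pairs : (n : ℕ) → List (Fin n × Fin n)
pairs n = concatMap (λ i → concatMap (λ j → if toℕ i <ᵇ toℕ j then (i , j) ∷ [] else []) (allFin n)) (allFin n)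

countB : ∀ {A : Set} → (A → Bool) → List A → ℕ
countB f [] = 0
countB f (a ∷ as) = if f a then suc (countB f as) else countB f as

edgesIn : ∀ {n} → Graph n → Subset n → ℕ
edgesIn {n} G S = countB (λ { (i , j) → inS S i ∧ inS S j ∧ adj G i j }) (pairs n)

missingIn : ∀ {n} → Graph n → Subset n → ℕ
missingIn {n} G S = countB (λ { (i , j) → inS S i ∧ inS S j ∧ not (adj G i j) }) (pairs n)

-- d(S) = |E(S)| / |S|  (set to 0 for empty S; only used on nonempty sets).
density : ∀ {n} → Graph n → Subset n → ℚ
density G S with ∣ S ∣
... | zero  = + 0 / 1
... | suc k = + edgesIn G S / suc k

-- d({V₁, V₂}) for the partition with V₁ = S and V₂ = complement of S.
density₂ : ∀ {n} → Graph n → Subset n → ℚ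
density₂ G S = density G S + density G (∁ S)

-- Write a = |V₁|, b = |V₂| = n − a. Each part satisfies 2(e + m) + s = s² for its size s, edge
-- count e and missing-edge count m, so d(V₁) = (a − 1)/2 and d(V₂) = (b − 1)/2 − x/b, whence
-- d({V₁, V₂}) = (n − 2)/2 − x/b, which grows with b. The proof compares the two partitions
-- in this form after clearing denominators.
module Submission where

open import Defs
open import Data.Bool using (Bool; true; false; _∧_; not; if_then_else_)
open import Data.Bool.Properties using (if-float)
open import Data.Fin using (Fin; toℕ) renaming (zero to fzero; suc to fsuc)
open import Data.Fin.Subset using (Subset; ∣_∣; ∁; Nonempty)
open import Data.Fin.Subset.Properties using (∣∁p∣≡n∸∣p∣; ∣p∣≤n; x∈p⇒∣p-x∣<∣p∣)
open import Data.List using (List; []; _∷_; _++_; [_]; map; concatMap; tabulate; allFin)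
open import Data.List.Properties using (map-tabulate; concatMap-map; concatMap-pure; map-concatMap; concatMap-cong)
open import Data.Nat using (ℕ; suc; _+_; _*_; _≤_; _<ᵇ_; z≤n; NonZero; >-nonZero)
open import Data.Nat.Properties using (+-suc; m+[n∸m]≡n; *-distribʳ-+; +-monoʳ-≤; +-monoˡ-≤; *-monoʳ-≤; +-cancelʳ-≤; *-cancelˡ-≤; *-assoc; ≤-<-trans; module ≤-Reasoning)
open import Data.Nat.Tactic.RingSolver using (solve)
open import Data.Product as Product using (_×_; _,_; proj₁; proj₂)
import Data.Integer as ℤ
open import Data.Integer.Properties using (pos-+; pos-*)
open import Data.Rational using (toℚᵘ) renaming (_≤_ to _≤ℚ_)
open import Data.Rational.Properties using (toℚᵘ-fromℚᵘ; toℚᵘ-homo-+; toℚᵘ-cancel-≤)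
open import Data.Rational.Unnormalised using (*≤*) renaming (_/_ to _/ᵘ_; _+_ to _+ᵘ_; _≤_ to _≤ᵘ_; _≃_ to _≃ᵘ_)
import Data.Rational.Unnormalised.Properties as ℚᵘ
open import Data.Vec using () renaming ([] to []ᵛ; _∷_ to _∷ᵛ_)
open import Function using (_∘_; id)
open import Relation.Binary.PropositionalEquality using (_≡_; refl; sym; trans; cong; cong₂; subst₂; module ≡-Reasoning)

countB-++ : ∀ {A : Set} (f : A → Bool) (xs ys : List A) → countB f (xs ++ ys) ≡ countB f xs + countB f ys
countB-++ f []       ys = refl
countB-++ f (x ∷ xs) ys with f x
... | true  = cong suc (countB-++ f xs ys)
... | false = countB-++ f xs ys

countB-map : ∀ {A B : Set} (f : B → Bool) (g : A → B) (xs : List A) → countB f (map g xs) ≡ countB (f ∘ g) xs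
countB-map f g []       = refl
countB-map f g (x ∷ xs) with f (g x)
... | true  = cong suc (countB-map f g xs)
... | false = countB-map f g xs

countB-false : ∀ {A : Set} (xs : List A) → countB (λ _ → false) xs ≡ 0
countB-false []       = refl
countB-false (_ ∷ xs) = countB-false xs

countB-∧-not : ∀ {A : Set} (f g h : A → Bool) (xs : List A) →
               countB (λ a → f a ∧ g a ∧ h a) xs + countB (λ a → f a ∧ g a ∧ not (h a)) xs
               ≡ countB (λ a → f a ∧ g a) xs
countB-∧-not f g h []       = refl
countB-∧-not f g h (x ∷ xs) with f x | g x | h x
... | true  | true  | true  = cong suc (countB-∧-not f g h xs)
... | true  | true  | false = trans (+-suc _ _) (cong suc (countB-∧-not f g h xs))
... | true  | false | _     = countB-∧-not f g h xs
... | false | _     | _     = countB-∧-not f g h xs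

tabulate-fsuc : ∀ n → tabulate fsuc ≡ map fsuc (allFin n)
tabulate-fsuc n = sym (map-tabulate id fsuc)

concatMap-tabulate-suc : ∀ {A : Set} {n} (g : Fin (suc n) → List A) →
                         concatMap g (tabulate fsuc) ≡ concatMap (g ∘ fsuc) (allFin n)
concatMap-tabulate-suc {n = n} g = trans (cong (concatMap g) (tabulate-fsuc n)) (concatMap-map g fsuc (allFin n))

pairsAbove : ∀ {n} → Fin n → List (Fin n × Fin n)
pairsAbove {n} i = concatMap (λ j → if toℕ i <ᵇ toℕ j then (i , j) ∷ [] else []) (allFin n)

shift : ∀ {n} → Fin n × Fin n → Fin (suc n) × Fin (suc n)
shift = Product.map fsuc fsuc

pairsAbove-zero : ∀ n → pairsAbove {suc n} fzero ≡ map (λ j → fzero , fsuc j) (allFin n)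
pairsAbove-zero n = begin
  pairsAbove fzero                            ≡⟨ concatMap-tabulate-suc (λ j → if 0 <ᵇ toℕ j then [ fzero , j ] else []) ⟩
  concatMap (λ j → [ fzero , fsuc j ]) (allFin n) ≡⟨ sym (concatMap-map [_] _ (allFin n)) ⟩
  concatMap [_] (map (λ j → fzero , fsuc j) (allFin n)) ≡⟨ concatMap-pure _ ⟩
  map (λ j → fzero , fsuc j) (allFin n)        ∎
  where open ≡-Reasoning

pairsAbove-suc : ∀ {n} (i : Fin n) → pairsAbove (fsuc i) ≡ map shift (pairsAbove i)
pairsAbove-suc {n} i = begin
  pairsAbove (fsuc i) ≡⟨ concatMap-tabulate-suc (λ j → if toℕ (fsuc i) <ᵇ toℕ j then [ fsuc i , j ] else []) ⟩
  concatMap (λ j → if toℕ i <ᵇ toℕ j then [ fsuc i , fsuc j ] else []) (allFin n)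
    ≡⟨ concatMap-cong (λ j → sym (if-float (map shift) (toℕ i <ᵇ toℕ j))) (allFin n) ⟩
  concatMap (map shift ∘ λ j → if toℕ i <ᵇ toℕ j then [ i , j ] else []) (allFin n)
    ≡⟨ sym (map-concatMap shift _ (allFin n)) ⟩
  map shift (pairsAbove i) ∎
  where open ≡-Reasoning

pairs-suc : ∀ n → pairs (suc n) ≡ map (λ j → fzero , fsuc j) (allFin n) ++ map shift (pairs n)
pairs-suc n = cong₂ _++_ (pairsAbove-zero n) (begin
  concatMap pairsAbove (tabulate fsuc)        ≡⟨ concatMap-tabulate-suc pairsAbove ⟩
  concatMap (pairsAbove ∘ fsuc) (allFin n)    ≡⟨ concatMap-cong pairsAbove-suc (allFin n) ⟩
  concatMap (map shift ∘ pairsAbove) (allFin n) ≡⟨ sym (map-concatMap shift pairsAbove (allFin n)) ⟩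
  map shift (pairs n)                         ∎)
  where open ≡-Reasoning

pairsIn : ∀ {n} → Subset n → ℕ
pairsIn {n} S = countB (λ { (i , j) → inS S i ∧ inS S j }) (pairs n)

countB-tabulate-suc : ∀ {n} (f : Fin (suc n) → Bool) → countB f (tabulate fsuc) ≡ countB (f ∘ fsuc) (allFin n)
countB-tabulate-suc {n} f = trans (cong (countB f) (tabulate-fsuc n)) (countB-map f fsuc (allFin n))

countB-inS : ∀ {n} (S : Subset n) → countB (inS S) (allFin n) ≡ ∣ S ∣
countB-inS []ᵛ           = refl
countB-inS (true  ∷ᵛ S) = cong suc (trans (countB-tabulate-suc (inS (true ∷ᵛ S))) (countB-inS S))
countB-inS (false ∷ᵛ S) = trans (countB-tabulate-suc (inS (false ∷ᵛ S))) (countB-inS S)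

pairsIn-∷ : ∀ {n} b (S : Subset n) → pairsIn (b ∷ᵛ S) ≡ (if b then ∣ S ∣ else 0) + pairsIn S
pairsIn-∷ {n} b S = begin
  pairsIn (b ∷ᵛ S)
    ≡⟨ cong (countB inPair) (pairs-suc n) ⟩
  countB inPair (map (λ j → fzero , fsuc j) (allFin n) ++ map shift (pairs n))
    ≡⟨ countB-++ inPair (map (λ j → fzero , fsuc j) (allFin n)) (map shift (pairs n)) ⟩
  countB inPair (map (λ j → fzero , fsuc j) (allFin n)) + countB inPair (map shift (pairs n))
    ≡⟨ cong₂ _+_ (countB-map inPair _ (allFin n)) (countB-map inPair shift (pairs n)) ⟩
  countB (λ j → b ∧ inS S j) (allFin n) + pairsIn S
    ≡⟨ cong (_+ pairsIn S) (neighbours b) ⟩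
  (if b then ∣ S ∣ else 0) + pairsIn S ∎
  where
  open ≡-Reasoning
  inPair : Fin (suc n) × Fin (suc n) → Bool
  inPair (i , j) = inS (b ∷ᵛ S) i ∧ inS (b ∷ᵛ S) j
  neighbours : ∀ b → countB (λ j → b ∧ inS S j) (allFin n) ≡ (if b then ∣ S ∣ else 0)
  neighbours true  = countB-inS S
  neighbours false = countB-false (allFin n)

pairsIn-square : ∀ {n} (S : Subset n) → 2 * pairsIn S + ∣ S ∣ ≡ ∣ S ∣ * ∣ S ∣
pairsIn-square []ᵛ = refl
pairsIn-square (true ∷ᵛ S) =
  trans (cong (λ p → 2 * p + suc ∣ S ∣) (pairsIn-∷ true S)) (square-step (pairsIn-square S))
  where
  square-step : ∀ {s p} → 2 * p + s ≡ s * s → 2 * (s + p) + suc s ≡ suc s * suc s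
  square-step {s} {p} h = begin
    2 * (s + p) + suc s         ≡⟨ solve (s ∷ p ∷ []) ⟩
    (2 * p + s) + (2 * s + 1)   ≡⟨ cong (_+ (2 * s + 1)) h ⟩
    s * s + (2 * s + 1)         ≡⟨ solve (s ∷ []) ⟩
    suc s * suc s               ∎
    where open ≡-Reasoning
pairsIn-square (false ∷ᵛ S) = trans (cong (λ p → 2 * p + ∣ S ∣) (pairsIn-∷ false S)) (pairsIn-square S)

edgesIn+missingIn≡pairsIn : ∀ {n} (G : Graph n) (S : Subset n) → edgesIn G S + missingIn G S ≡ pairsIn S
edgesIn+missingIn≡pairsIn {n} G S =
  countB-∧-not (λ p → inS S (proj₁ p)) (λ p → inS S (proj₂ p)) (λ p → adj G (proj₁ p) (proj₂ p)) (pairs n)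

edgesIn-missingIn-square : ∀ {n} (G : Graph n) (S : Subset n) →
                           2 * (edgesIn G S + missingIn G S) + ∣ S ∣ ≡ ∣ S ∣ * ∣ S ∣
edgesIn-missingIn-square G S = trans (cong (λ p → 2 * p + ∣ S ∣) (edgesIn+missingIn≡pairsIn G S)) (pairsIn-square S)

∣p∣+∣∁p∣≡n : ∀ {n} (S : Subset n) → ∣ S ∣ + ∣ ∁ S ∣ ≡ n
∣p∣+∣∁p∣≡n S = trans (cong (∣ S ∣ +_) (∣∁p∣≡n∸∣p∣ S)) (m+[n∸m]≡n (∣p∣≤n S))

nonempty⇒nonZero : ∀ {n} {S : Subset n} → Nonempty S → NonZero ∣ S ∣
nonempty⇒nonZero (_ , x∈S) = >-nonZero (≤-<-trans z≤n (x∈p⇒∣p-x∣<∣p∣ x∈S))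

partition-identity : ∀ {a b e₁ e₂ m₁ m₂} → 2 * (e₁ + m₁) + a ≡ a * a → 2 * (e₂ + m₂) + b ≡ b * b →
                     2 * (e₁ * b + e₂ * a) + (2 * (m₁ * b + m₂ * a) + 2 * (a * b)) ≡ a * b * (a + b)
partition-identity {a} {b} {e₁} {e₂} {m₁} {m₂} h₁ h₂ = begin
  2 * (e₁ * b + e₂ * a) + (2 * (m₁ * b + m₂ * a) + 2 * (a * b))
    ≡⟨ solve (a ∷ b ∷ e₁ ∷ e₂ ∷ m₁ ∷ m₂ ∷ []) ⟩
  (2 * (e₁ + m₁) + a) * b + (2 * (e₂ + m₂) + b) * a
    ≡⟨ cong₂ (λ u v → u * b + v * a) h₁ h₂ ⟩
  a * a * b + b * b * a
    ≡⟨ solve (a ∷ b ∷ []) ⟩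
  a * b * (a + b) ∎
  where open ≡-Reasoning

-- q/m = (t − c/m)/k, so the fractions q/m and q′/m′ compare opposite to c/m and c′/m′.
cross-mul-≤ : ∀ k .{{_ : NonZero k}} {q c m q′ c′ m′ t} →
              k * q + c ≡ m * t → k * q′ + c′ ≡ m′ * t → c′ * m ≤ c * m′ → q * m′ ≤ q′ * m
cross-mul-≤ k {q} {c} {m} {q′} {c′} {m′} {t} eq eq′ c′m≤cm′ =
  *-cancelˡ-≤ k (subst₂ _≤_ (*-assoc k q m′) (*-assoc k q′ m)
    (+-cancelʳ-≤ (c * m′) (k * q * m′) (k * q′ * m) (begin
      k * q * m′ + c * m′    ≡⟨ *-distribʳ-+ m′ (k * q) c ⟨
      (k * q + c) * m′       ≡⟨ cong (_* m′) eq ⟩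
      m * t * m′             ≡⟨ solve (m ∷ t ∷ m′ ∷ []) ⟩
      m′ * t * m             ≡⟨ cong (_* m) eq′ ⟨
      (k * q′ + c′) * m      ≡⟨ *-distribʳ-+ m (k * q′) c′ ⟩
      k * q′ * m + c′ * m    ≤⟨ +-monoʳ-≤ (k * q′ * m) c′m≤cm′ ⟩
      k * q′ * m + c * m′    ∎)))
  where open ≤-Reasoning

-- (2xa + 2ab)/(ab) = 2x/b + 2 decreases in b.
deficit-≤ : ∀ x a a′ {b b′} → b ≤ b′ →
            (2 * (x * a′) + 2 * (a′ * b′)) * (a * b) ≤ (2 * (x * a) + 2 * (a * b)) * (a′ * b′)
deficit-≤ x a a′ {b} {b′} b≤b′ = begin
  (2 * (x * a′) + 2 * (a′ * b′)) * (a * b) ≡⟨ solve (x ∷ a ∷ b ∷ a′ ∷ b′ ∷ []) ⟩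
  2 * a * a′ * (x * b + b * b′)            ≤⟨ *-monoʳ-≤ (2 * a * a′) (+-monoˡ-≤ (b * b′) (*-monoʳ-≤ x b≤b′)) ⟩
  2 * a * a′ * (x * b′ + b * b′)           ≡⟨ solve (x ∷ a ∷ b ∷ a′ ∷ b′ ∷ []) ⟩
  (2 * (x * a) + 2 * (a * b)) * (a′ * b′) ∎
  where open ≤-Reasoning

density₂-numerator : ∀ {n} → Graph n → Subset n → ℕ
density₂-numerator G S = edgesIn G S * ∣ ∁ S ∣ + edgesIn G (∁ S) * ∣ S ∣

density₂-numerator-identity : ∀ {n x} (G : Graph n) (S : Subset n) →
                              missingIn G S ≡ 0 → missingIn G (∁ S) ≡ x →
                              let a = ∣ S ∣; b = ∣ ∁ S ∣ in
                              2 * density₂-numerator G S + (2 * (x * a) + 2 * (a * b)) ≡ a * b * n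
density₂-numerator-identity {n} {x} G S m₁≡0 m₂≡x = trans
  (subst₂ (λ m₁ m₂ → 2 * (e₁ * b + e₂ * a) + (2 * (m₁ * b + m₂ * a) + 2 * (a * b)) ≡ a * b * (a + b)) m₁≡0 m₂≡x
    (partition-identity {e₁ = e₁} {e₂ = e₂} (edgesIn-missingIn-square G S) (edgesIn-missingIn-square G (∁ S))))
  (cong (a * b *_) (∣p∣+∣∁p∣≡n S))
  where
  a = ∣ S ∣
  b = ∣ ∁ S ∣
  e₁ = edgesIn G S
  e₂ = edgesIn G (∁ S)

toℚᵘ-density : ∀ {n} (G : Graph n) (S : Subset n) .{{_ : NonZero ∣ S ∣}} →
               toℚᵘ (density G S) ≃ᵘ ℤ.+ edgesIn G S /ᵘ ∣ S ∣
toℚᵘ-density G S with ∣ S ∣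
... | suc _ = toℚᵘ-fromℚᵘ _

fraction-sum-≤ : ∀ p q p′ q′ a b a′ b′
                 .{{_ : NonZero a}} .{{_ : NonZero b}} .{{_ : NonZero a′}} .{{_ : NonZero b′}} →
                 (p * b + q * a) * (a′ * b′) ≤ (p′ * b′ + q′ * a′) * (a * b) →
                 ℤ.+ p /ᵘ a +ᵘ ℤ.+ q /ᵘ b ≤ᵘ ℤ.+ p′ /ᵘ a′ +ᵘ ℤ.+ q′ /ᵘ b′
fraction-sum-≤ p q p′ q′ a@(suc _) b@(suc _) a′@(suc _) b′@(suc _) h =
  *≤* (subst₂ ℤ._≤_ (cast p q a b (a′ * b′)) (cast p′ q′ a′ b′ (a * b)) (ℤ.+≤+ h))
  where
  cast : ∀ p q a b m → ℤ.+ ((p * b + q * a) * m) ≡ (ℤ.+ p ℤ.* ℤ.+ b ℤ.+ ℤ.+ q ℤ.* ℤ.+ a) ℤ.* ℤ.+ m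
  cast p q a b m = trans (pos-* (p * b + q * a) m)
    (cong (ℤ._* ℤ.+ m) (trans (pos-+ (p * b) (q * a)) (cong₂ ℤ._+_ (pos-* p b) (pos-* q a))))

toℚᵘ-density₂ : ∀ {n} (G : Graph n) (S : Subset n) .{{_ : NonZero ∣ S ∣}} .{{_ : NonZero ∣ ∁ S ∣}} →
                toℚᵘ (density₂ G S) ≃ᵘ ℤ.+ edgesIn G S /ᵘ ∣ S ∣ +ᵘ ℤ.+ edgesIn G (∁ S) /ᵘ ∣ ∁ S ∣
toℚᵘ-density₂ G S = ℚᵘ.≃-trans (toℚᵘ-homo-+ (density G S) (density G (∁ S)))
                                (ℚᵘ.+-cong (toℚᵘ-density G S) (toℚᵘ-density G (∁ S)))

density₂-≤ : ∀ {n} (G : Graph n) (S S′ : Subset n)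
             .{{_ : NonZero ∣ S ∣}} .{{_ : NonZero ∣ ∁ S ∣}} .{{_ : NonZero ∣ S′ ∣}} .{{_ : NonZero ∣ ∁ S′ ∣}} →
             density₂-numerator G S * (∣ S′ ∣ * ∣ ∁ S′ ∣) ≤ density₂-numerator G S′ * (∣ S ∣ * ∣ ∁ S ∣) →
             density₂ G S ≤ℚ density₂ G S′
density₂-≤ G S S′ h = toℚᵘ-cancel-≤
  (ℚᵘ.≤-respˡ-≃ (ℚᵘ.≃-sym (toℚᵘ-density₂ G S)) (ℚᵘ.≤-respʳ-≃ (ℚᵘ.≃-sym (toℚᵘ-density₂ G S′))
    (fraction-sum-≤ _ _ _ _ (∣ S ∣) (∣ ∁ S ∣) (∣ S′ ∣) (∣ ∁ S′ ∣) h)))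

lemma19 : (n : ℕ) (G : Graph n) (x : ℕ) (V₁ V₁' : Subset n)
          → Nonempty V₁ → Nonempty (∁ V₁) → Nonempty V₁' → Nonempty (∁ V₁')
          → ∣ V₁ ∣ ≤ ∣ ∁ V₁ ∣ → ∣ V₁' ∣ ≤ ∣ ∁ V₁' ∣
          → missingIn G V₁ ≡ 0 → missingIn G V₁' ≡ 0
          → missingIn G (∁ V₁) ≡ x → missingIn G (∁ V₁') ≡ x
          → ∣ ∁ V₁ ∣ ≤ ∣ ∁ V₁' ∣
          → density₂ G V₁ ≤ℚ density₂ G V₁'
lemma19 n G x V₁ V₁' ne₁ ne₂ ne₁' ne₂' _ _ m₁ m₁' m₂ m₂' b≤b' =
  density₂-≤ G V₁ V₁'
    (cross-mul-≤ 2 {q = density₂-numerator G V₁} {q′ = density₂-numerator G V₁'}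
      (density₂-numerator-identity G V₁ m₁ m₂)
      (density₂-numerator-identity G V₁' m₁' m₂')
      (deficit-≤ x (∣ V₁ ∣) (∣ V₁' ∣) b≤b'))
  where
  instance
    _ = nonempty⇒nonZero ne₁
    _ = nonempty⇒nonZero ne₂
    _ = nonempty⇒nonZero ne₁'
    _ = nonempty⇒nonZero ne₂'
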